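{- For every positive integer $n$, writing $B_m(n)=\sum_{k=1}^n (-1)^{k-1}\binom{2n}{n-k}k^m$, $$\begin{aligned} B_1(n) &= \binom{2n}{n}\frac{n}{2(2n-1)},\\ B_3(n) &= \binom{2n}{n}\frac{ -n^2}{2(2n-1)(2n-3)},\\ B_5(n) &= \binom{2n}{n}\frac{n^2(4n-1)}{2(2n-1)(2n-3)(2n-5)},\\ B_7(n) &= \binom{2n}{n}\frac{ -n^2(34n^2-24n+5)}{2(2n-1)(2n-3)(2n-5)(2n-7)},\\ B_9(n) &= \binom{2n}{n}\frac{n^2(496n^3-672n^2+344n-63)}{2(2n-1)(2n-3)(2n-5)(2n-7)(2n-9)}.\end{aligned}$$ -}

module Defs where

open import Data.Nat using (ℕ; zero; suc; _^_)
open import Data.Nat.Combinatorics using (_C_)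
open import Data.Integer using (ℤ; +_; -_; _+_; _*_; _-_)
import Data.Nat as N

neg1^ : ℕ → ℤ
neg1^ zero = + 1
neg1^ (suc j) = - neg1^ j

-- term of B_m(n) at index k = suc j  (k = 1 … n):
--   (-1)^(k-1) * binom(2n, n-k) * k^m
term : ℕ → ℕ → ℕ → ℤ
term m n j = neg1^ j * (+ ((2 N.* n) C (n N.∸ suc j))) * (+ (suc j ^ m))

sumTo : (ℕ → ℤ) → ℕ → ℤ
sumTo f zero = + 0
sumTo f (suc n) = sumTo f n + f n

B : ℕ → ℕ → ℤ
B m n = sumTo (term m n) n

cbin : ℕ → ℤ
cbin n = + ((2 N.* n) C n)

2n- : ℕ → ℕ → ℤ
2n- n c = + (2 N.* n) - + c

module Submission where

-- Since k² = n² − (n − k)(n + k) and (n − k)(n + k)·C(2n, n − k) = 2n(2n − 1)·C(2n − 2, n − 1 − k),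
-- the sums satisfy B_{m+2}(n) = n² B_m(n) − 2n(2n − 1) B_m(n − 1).
-- Write B_m(n) = C(2n, n) N_m(n) / D_m(n) with D_m(n) = 2(2n − 1)(2n − 3)⋯(2n − m).
-- As D_{m+2}(n) = (2n − m − 2) D_m(n) = (2n − 1) D_m(n − 1) and 2n(2n − 1)·C(2n − 2, n − 1) = n²·C(2n, n),
-- the recurrence becomes N_{m+2}(n) = n²((2n − m − 2) N_m(n) − (2n − 1) N_m(n − 1)), a polynomial identity
-- that produces each numerator of the statement from the previous one.
-- The base case telescopes: with G(j) = (−1)^j (n − j)(2j + 1) C(2n, n − j), the summand of index j + 1
-- times 2(2n − 1) is G(j) − G(j + 1), and G(n) = 0.

open import Defs
open import Data.Nat.Base as ℕ using (ℕ; zero; suc; _<_; _≤_)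
open import Data.Nat.Combinatorics using (_C_; nC1≡n; nCk+nC[k+1]≡[n+1]C[k+1])
open import Data.Product using (_×_; _,_)
open import Relation.Binary.PropositionalEquality
open ≡-Reasoning

module _ where
  open import Data.Nat.Base using (_+_; _*_; _∸_)
  open import Data.Nat.Properties
    using (+-identityʳ; +-suc; +-assoc; +-comm; *-comm; *-assoc; *-suc; *-zeroʳ;
           +-cancelʳ-≡; +-∸-assoc; m∸n+n≡m; *-commutativeSemigroup)
  open import Algebra.Properties.CommutativeSemigroup *-commutativeSemigroup using (x∙yz≈y∙xz)
  import Data.Nat.Tactic.RingSolver as ℕ-Solver

  [1+k]*nC[1+k]+k*nCk≡n*nCk : ∀ n k → suc k * (n C suc k) + k * (n C k) ≡ n * (n C k)
  [1+k]*nC[1+k]+k*nCk≡n*nCk zero    zero    = refl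
  [1+k]*nC[1+k]+k*nCk≡n*nCk zero    (suc k) = cong₂ _+_ (*-zeroʳ (suc (suc k))) (*-zeroʳ (suc k))
  [1+k]*nC[1+k]+k*nCk≡n*nCk (suc n) zero    =
    trans (+-identityʳ _) (trans (*-comm 1 _) (cong (_* 1) (nC1≡n (suc n))))
  [1+k]*nC[1+k]+k*nCk≡n*nCk (suc n) (suc k) = begin
    suc (suc k) * (suc n C suc (suc k)) + suc k * (suc n C suc k)
      ≡⟨ cong₂ (λ u v → suc (suc k) * u + suc k * v) (pascal (suc k)) (pascal k) ⟨
    suc (suc k) * (b + c) + suc k * (a + b)
      ≡⟨ regroup k a b c ⟩
    (suc (suc k) * c + suc k * b) + (suc k * b + k * a) + (a + b)
      ≡⟨ cong₂ (λ u v → u + v + (a + b)) ([1+k]*nC[1+k]+k*nCk≡n*nCk n (suc k))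
                                          ([1+k]*nC[1+k]+k*nCk≡n*nCk n k) ⟩
    n * b + n * a + (a + b)
      ≡⟨ collect n a b ⟩
    suc n * (a + b)
      ≡⟨ cong (suc n *_) (pascal k) ⟩
    suc n * (suc n C suc k) ∎
    where
    a = n C k
    b = n C suc k
    c = n C suc (suc k)
    pascal : ∀ i → n C i + n C suc i ≡ suc n C suc i
    pascal = nCk+nC[k+1]≡[n+1]C[k+1] n
    regroup : ∀ k a b c → suc (suc k) * (b + c) + suc k * (a + b)
                        ≡ (suc (suc k) * c + suc k * b) + (suc k * b + k * a) + (a + b)
    regroup = ℕ-Solver.solve-∀
    collect : ∀ n a b → n * b + n * a + (a + b) ≡ suc n * (a + b)
    collect = ℕ-Solver.solve-∀

  [1+k]*[1+n]C[1+k]≡[1+n]*nCk : ∀ n k → suc k * (suc n C suc k) ≡ suc n * (n C k)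
  [1+k]*[1+n]C[1+k]≡[1+n]*nCk n k = begin
    suc k * (suc n C suc k)                      ≡⟨ cong (suc k *_) (nCk+nC[k+1]≡[n+1]C[k+1] n k) ⟨
    suc k * (n C k + n C suc k)                  ≡⟨ regroup k (n C k) (n C suc k) ⟩
    n C k + (suc k * (n C suc k) + k * (n C k))  ≡⟨ cong (n C k +_) ([1+k]*nC[1+k]+k*nCk≡n*nCk n k) ⟩
    n C k + n * (n C k)                          ∎
    where
    regroup : ∀ k a b → suc k * (a + b) ≡ a + (suc k * b + k * a)
    regroup = ℕ-Solver.solve-∀

  [1+a]*[1+a+b]C[1+a]≡[1+b]*[1+a+b]Ca :
    ∀ a b → suc a * (suc (a + b) C suc a) ≡ suc b * (suc (a + b) C a)
  [1+a]*[1+a+b]C[1+a]≡[1+b]*[1+a+b]Ca a b = +-cancelʳ-≡ (a * c) _ _ (begin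
    suc a * (suc (a + b) C suc a) + a * c ≡⟨ [1+k]*nC[1+k]+k*nCk≡n*nCk (suc (a + b)) a ⟩
    suc (a + b) * c                       ≡⟨ split a b c ⟩
    suc b * c + a * c                     ∎)
    where
    c = suc (a + b) C a
    split : ∀ a b c → suc (a + b) * c ≡ suc b * c + a * c
    split = ℕ-Solver.solve-∀

  [1+a]*[1+b]*[2+a+b]C[1+a]≡[2+a+b]*[1+a+b]*[a+b]Ca : ∀ a b →
    suc a * suc b * (suc (suc (a + b)) C suc a) ≡ suc (suc (a + b)) * suc (a + b) * ((a + b) C a)
  [1+a]*[1+b]*[2+a+b]C[1+a]≡[2+a+b]*[1+a+b]*[a+b]Ca a b = begin
    suc a * suc b * (suc M C suc a)    ≡⟨ *-assoc (suc a) (suc b) (suc M C suc a) ⟩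
    suc a * (suc b * (suc M C suc a))  ≡⟨ x∙yz≈y∙xz (suc a) (suc b) (suc M C suc a) ⟩
    suc b * (suc a * (suc M C suc a))  ≡⟨ cong (suc b *_) ([1+k]*[1+n]C[1+k]≡[1+n]*nCk M a) ⟩
    suc b * (suc M * (M C a))          ≡⟨ x∙yz≈y∙xz (suc b) (suc M) (M C a) ⟩
    suc M * (suc b * (M C a))          ≡⟨ cong (suc M *_) ([1+a]*[1+a+b]C[1+a]≡[1+b]*[1+a+b]Ca a b) ⟨
    suc M * (suc a * (M C suc a))      ≡⟨ cong (suc M *_) ([1+k]*[1+n]C[1+k]≡[1+n]*nCk (a + b) a) ⟩
    suc M * (M * ((a + b) C a))        ≡⟨ *-assoc (suc M) M ((a + b) C a) ⟨
    suc M * M * ((a + b) C a)          ∎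
    where M = suc (a + b)

  [n∸j]*[2n]C[n∸j]≡[n+1+j]*[2n]C[n∸1+j] : ∀ {n j} → j < n →
    (n ∸ j) * ((2 * n) C (n ∸ j)) ≡ (n + suc j) * ((2 * n) C (n ∸ suc j))
  [n∸j]*[2n]C[n∸j]≡[n+1+j]*[2n]C[n∸1+j] {n} {j} j<n =
    subst₂ (λ s N → s * (N C s) ≡ (n + suc j) * (N C a)) (sym (+-∸-assoc 1 j<n)) a+b+1≡2n
      (trans ([1+a]*[1+a+b]C[1+a]≡[1+b]*[1+a+b]Ca a (n + j))
             (cong (_* (suc (a + (n + j)) C a)) (sym (+-suc n j))))
    where
    a = n ∸ suc j
    shuffle : ∀ a n j → suc (a + (n + j)) ≡ a + suc j + n
    shuffle = ℕ-Solver.solve-∀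
    a+b+1≡2n : suc (a + (n + j)) ≡ 2 * n
    a+b+1≡2n = begin
      suc (a + (n + j)) ≡⟨ shuffle a n j ⟩
      a + suc j + n     ≡⟨ cong (_+ n) (m∸n+n≡m j<n) ⟩
      n + n             ≡⟨ cong (n +_) (+-identityʳ n) ⟨
      2 * n             ∎

  [1+p∸k]*[1+p+k]*[2+2p]C[1+p∸k]≡[2+2p]*[1+2p]*[2p]C[p∸k] : ∀ {p k} → k ≤ p →
    (suc p ∸ k) * (suc p + k) * ((2 * suc p) C (suc p ∸ k))
    ≡ 2 * suc p * suc (2 * p) * ((2 * p) C (p ∸ k))
  [1+p∸k]*[1+p+k]*[2+2p]C[1+p∸k]≡[2+2p]*[1+2p]*[2p]C[p∸k] {p} {k} k≤p =
    subst (λ N → (suc p ∸ k) * (suc p + k) * (N C (suc p ∸ k)) ≡ N * suc (2 * p) * ((2 * p) C a))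
      (sym (*-suc 2 p))
      (subst₂ (λ s N → s * suc (p + k) * (suc (suc N) C s) ≡ suc (suc N) * suc N * (N C a))
        (sym (+-∸-assoc 1 k≤p)) a+b≡2p
        ([1+a]*[1+b]*[2+a+b]C[1+a]≡[2+a+b]*[1+a+b]*[a+b]Ca a (p + k)))
    where
    a = p ∸ k
    a+b≡2p : a + (p + k) ≡ 2 * p
    a+b≡2p = begin
      a + (p + k) ≡⟨ cong (a +_) (+-comm p k) ⟩
      a + (k + p) ≡⟨ +-assoc a k p ⟨
      a + k + p   ≡⟨ cong (_+ p) (m∸n+n≡m k≤p) ⟩
      p + p       ≡⟨ cong (p +_) (+-identityʳ p) ⟨
      2 * p       ∎

open import Data.Nat.Properties using (<⇒≤; n<1+n; m≤n⇒m≤1+n; m<n⇒m<1+n; *-suc; *-identityʳ)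
open import Data.Integer.Base using (ℤ; +_; -_; -[1+_]; _+_; _*_; _-_)
open import Data.Integer.Properties
  using (pos-*; m-n≡m⊖n; ⊖-≥; *-zeroʳ; *-identityˡ; *-assoc; +-identityʳ; +-inverseʳ; *-distribˡ-+)
open import Data.Integer.Tactic.RingSolver using (solve-∀)

m-n≡m∸n : ∀ {m n} → n ℕ.≤ m → + m - + n ≡ + (m ℕ.∸ n)
m-n≡m∸n {m} {n} n≤m = trans (m-n≡m⊖n m n) (⊖-≥ n≤m)

2n-c≡2*n-c : ∀ n c → 2n- n c ≡ + 2 * + n - + c
2n-c≡2*n-c n c = cong (_- + c) (pos-* 2 n)

central-binomial-ratio : ∀ {n j} → j < n →
  (+ n - + j) * + ((2 ℕ.* n) C (n ℕ.∸ j)) ≡ (+ n + + suc j) * + ((2 ℕ.* n) C (n ℕ.∸ suc j))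
central-binomial-ratio {n} {j} j<n = begin
  (+ n - + j) * + C₀             ≡⟨ cong (_* + C₀) (m-n≡m∸n (<⇒≤ j<n)) ⟩
  + (n ℕ.∸ j) * + C₀             ≡⟨ pos-* (n ℕ.∸ j) C₀ ⟨
  + ((n ℕ.∸ j) ℕ.* C₀)           ≡⟨ cong +_ ([n∸j]*[2n]C[n∸j]≡[n+1+j]*[2n]C[n∸1+j] j<n) ⟩
  + ((n ℕ.+ suc j) ℕ.* C₁)       ≡⟨ pos-* (n ℕ.+ suc j) C₁ ⟩
  (+ n + + suc j) * + C₁         ∎
  where
  C₀ = (2 ℕ.* n) C (n ℕ.∸ j)
  C₁ = (2 ℕ.* n) C (n ℕ.∸ suc j)

central-binomial-descent : ∀ {p k} → k ℕ.≤ p → let n = suc p in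
  (+ n * + n - + k * + k) * + ((2 ℕ.* n) C (n ℕ.∸ k))
  ≡ + (2 ℕ.* n) * 2n- n 1 * + ((2 ℕ.* p) C (p ℕ.∸ k))
central-binomial-descent {p} {k} k≤p = begin
  (+ n * + n - + k * + k) * + C₀
    ≡⟨ cong (_* + C₀) (difference-of-squares (+ n) (+ k)) ⟩
  (+ n - + k) * (+ n + + k) * + C₀
    ≡⟨ cong (λ d → d * (+ n + + k) * + C₀) (m-n≡m∸n (m≤n⇒m≤1+n k≤p)) ⟩
  + (n ℕ.∸ k) * + (n ℕ.+ k) * + C₀
    ≡⟨ pos-*³ (n ℕ.∸ k) (n ℕ.+ k) C₀ ⟨
  + ((n ℕ.∸ k) ℕ.* (n ℕ.+ k) ℕ.* C₀)
    ≡⟨ cong +_ ([1+p∸k]*[1+p+k]*[2+2p]C[1+p∸k]≡[2+2p]*[1+2p]*[2p]C[p∸k] k≤p) ⟩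
  + (2 ℕ.* n ℕ.* suc (2 ℕ.* p) ℕ.* C₁)
    ≡⟨ pos-*³ (2 ℕ.* n) (suc (2 ℕ.* p)) C₁ ⟩
  + (2 ℕ.* n) * + suc (2 ℕ.* p) * + C₁
    ≡⟨ cong (λ e → + (2 ℕ.* n) * e * + C₁) (cong (λ x → + x - + 1) (*-suc 2 p)) ⟨
  + (2 ℕ.* n) * 2n- n 1 * + C₁ ∎
  where
  n = suc p
  C₀ = (2 ℕ.* n) C (n ℕ.∸ k)
  C₁ = (2 ℕ.* p) C (p ℕ.∸ k)
  difference-of-squares : ∀ x y → x * x - y * y ≡ (x - y) * (x + y)
  difference-of-squares = solve-∀
  pos-*³ : ∀ a b c → + (a ℕ.* b ℕ.* c) ≡ + a * + b * + c
  pos-*³ a b c = trans (pos-* (a ℕ.* b) c) (cong (_* + c) (pos-* a b))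

sumTo-telescope : ∀ (D : ℤ) (f g : ℕ → ℤ) n → (∀ j → j < n → D * f j ≡ g j - g (suc j)) →
  D * sumTo f n ≡ g 0 - g n
sumTo-telescope D f g zero    _    = trans (*-zeroʳ D) (sym (+-inverseʳ (g 0)))
sumTo-telescope D f g (suc n) step = begin
  D * (sumTo f n + f n)                   ≡⟨ *-distribˡ-+ D (sumTo f n) (f n) ⟩
  D * sumTo f n + D * f n
    ≡⟨ cong₂ _+_ (sumTo-telescope D f g n (λ j j<n → step j (m<n⇒m<1+n j<n))) (step n (n<1+n n)) ⟩
  (g 0 - g n) + (g n - g (suc n))         ≡⟨ cancel (g 0) (g n) (g (suc n)) ⟩
  g 0 - g (suc n)                         ∎
  where
  cancel : ∀ a b c → (a - b) + (b - c) ≡ a - c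
  cancel = solve-∀

sumTo-combination : ∀ (a b : ℤ) (f g h : ℕ → ℤ) n → (∀ j → j < n → h j ≡ a * f j - b * g j) →
  sumTo h n ≡ a * sumTo f n - b * sumTo g n
sumTo-combination a b f g h zero    _   = sym (combine-zero a b)
  where
  combine-zero : ∀ a b → a * + 0 - b * + 0 ≡ + 0
  combine-zero = solve-∀
sumTo-combination a b f g h (suc n) hyp = begin
  sumTo h n + h n
    ≡⟨ cong₂ _+_ (sumTo-combination a b f g h n (λ j j<n → hyp j (m<n⇒m<1+n j<n))) (hyp n (n<1+n n)) ⟩
  (a * sumTo f n - b * sumTo g n) + (a * f n - b * g n)
    ≡⟨ collect a b (sumTo f n) (sumTo g n) (f n) (g n) ⟩
  a * (sumTo f n + f n) - b * (sumTo g n + g n) ∎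
  where
  collect : ∀ a b F G x y → (a * F - b * G) + (a * x - b * y) ≡ a * (F + x) - b * (G + y)
  collect = solve-∀

B₁-closed-form : ∀ n → + 2 * 2n- n 1 * B 1 n ≡ cbin n * + n
B₁-closed-form n = begin
  + 2 * 2n- n 1 * B 1 n
    ≡⟨ sumTo-telescope (+ 2 * 2n- n 1) (term 1 n) G n step ⟩
  G 0 - G n
    ≡⟨ endpoints (cbin n) (neg1^ n) (+ ((2 ℕ.* n) C (n ℕ.∸ n))) (+ n) (+ 2 * + n + + 1) ⟩
  cbin n * + n ∎
  where
  G : ℕ → ℤ
  G j = neg1^ j * ((+ n - + j) * + ((2 ℕ.* n) C (n ℕ.∸ j))) * (+ 2 * + j + + 1)
  endpoints : ∀ c s c′ x y →
    + 1 * ((x - + 0) * c) * (+ 2 * + 0 + + 1) - s * ((x - x) * c′) * y ≡ c * x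
  endpoints = solve-∀
  antidifference : ∀ s c x j →
    + 2 * (+ 2 * x - + 1) * (s * c * (+ 1 + j))
    ≡ s * ((x + (+ 1 + j)) * c) * (+ 2 * j + + 1)
      - (- s) * ((x - (+ 1 + j)) * c) * (+ 2 * (+ 1 + j) + + 1)
  antidifference = solve-∀
  step : ∀ j → j < n → + 2 * 2n- n 1 * term 1 n j ≡ G j - G (suc j)
  step j j<n = begin
    + 2 * 2n- n 1 * (neg1^ j * + Cₖ * + (suc j ℕ.^ 1))
      ≡⟨ cong₂ (λ e k → + 2 * e * (neg1^ j * + Cₖ * k)) (2n-c≡2*n-c n 1)
               (cong +_ (*-identityʳ (suc j))) ⟩
    + 2 * (+ 2 * + n - + 1) * (neg1^ j * + Cₖ * (+ 1 + + j))
      ≡⟨ antidifference (neg1^ j) (+ Cₖ) (+ n) (+ j) ⟩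
    neg1^ j * ((+ n + + suc j) * + Cₖ) * (+ 2 * + j + + 1) - G (suc j)
      ≡⟨ cong (λ a → neg1^ j * a * (+ 2 * + j + + 1) - G (suc j)) (central-binomial-ratio j<n) ⟨
    G j - G (suc j) ∎
    where Cₖ = (2 ℕ.* n) C (n ℕ.∸ suc j)

B-recurrence : ∀ m p → let n = suc p in
  B (2 ℕ.+ m) n ≡ + n * + n * B m n - + (2 ℕ.* n) * 2n- n 1 * B m p
B-recurrence m p = begin
  sumTo (term (2 ℕ.+ m) n) p + term (2 ℕ.+ m) n p
    ≡⟨ cong₂ _+_ (sumTo-combination (+ n * + n) c (term m n) (term m p) (term (2 ℕ.+ m) n) p
                                    termwise)
                 last-term ⟩
  (+ n * + n * sumTo (term m n) p - c * B m p) + + n * + n * term m n p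
    ≡⟨ regroup (+ n * + n) c (sumTo (term m n) p) (B m p) (term m n p) ⟩
  + n * + n * B m n - c * B m p ∎
  where
  n = suc p
  c = + (2 ℕ.* n) * 2n- n 1
  regroup : ∀ a c S S′ t → (a * S - c * S′) + a * t ≡ a * (S + t) - c * S′
  regroup = solve-∀
  pos-k²K : ∀ k K → + (k ℕ.* (k ℕ.* K)) ≡ + k * + k * + K
  pos-k²K k K =
    trans (pos-* k (k ℕ.* K)) (trans (cong (+ k *_) (pos-* k K)) (sym (*-assoc (+ k) (+ k) (+ K))))
  factor-square : ∀ s c x K → s * c * (x * x * K) ≡ x * x * (s * c * K)
  factor-square = solve-∀
  last-term : term (2 ℕ.+ m) n p ≡ + n * + n * term m n p
  last-term = trans (cong (neg1^ p * + Cₙ *_) (pos-k²K n (n ℕ.^ m)))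
                    (factor-square (neg1^ p) (+ Cₙ) (+ n) (+ (n ℕ.^ m)))
    where Cₙ = (2 ℕ.* n) C (n ℕ.∸ suc p)
  split-square : ∀ s c K x y →
    s * c * (y * y * K) ≡ x * x * (s * c * K) - s * K * ((x * x - y * y) * c)
  split-square = solve-∀
  reorder : ∀ a b s c c′ K → a - s * K * (b * c′) ≡ a - b * (s * c′ * K)
  reorder = solve-∀
  termwise : ∀ j → j < p → term (2 ℕ.+ m) n j ≡ + n * + n * term m n j - c * term m p j
  termwise j j<p = begin
    s * + C₀ * + (k ℕ.* (k ℕ.* K))
      ≡⟨ cong (s * + C₀ *_) (pos-k²K k K) ⟩
    s * + C₀ * (+ k * + k * + K)
      ≡⟨ split-square s (+ C₀) (+ K) (+ n) (+ k) ⟩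
    + n * + n * (s * + C₀ * + K) - s * + K * ((+ n * + n - + k * + k) * + C₀)
      ≡⟨ cong (λ x → + n * + n * (s * + C₀ * + K) - s * + K * x) (central-binomial-descent j<p) ⟩
    + n * + n * (s * + C₀ * + K) - s * + K * (c * + C₁)
      ≡⟨ reorder (+ n * + n * (s * + C₀ * + K)) c s (+ C₀) (+ C₁) (+ K) ⟩
    + n * + n * (s * + C₀ * + K) - c * (s * + C₁ * + K) ∎
    where
    s = neg1^ j
    k = suc j
    K = k ℕ.^ m
    C₀ = (2 ℕ.* n) C (n ℕ.∸ k)
    C₁ = (2 ℕ.* p) C (p ℕ.∸ k)

cbin-descent : ∀ p → let n = suc p in + (2 ℕ.* n) * 2n- n 1 * cbin p ≡ + n * + n * cbin n
cbin-descent p =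
  sym (trans (cong (_* cbin (suc p)) (sym (+-identityʳ (+ suc p * + suc p))))
             (central-binomial-descent {p} ℕ.z≤n))

odd : ℕ → ℕ
odd zero    = 1
odd (suc t) = 2 ℕ.+ odd t

denominator : ℕ → ℕ → ℤ
denominator zero    n = + 2 * 2n- n 1
denominator (suc t) n = denominator t n * 2n- n (odd (suc t))

2n-[2+c]-shift : ∀ p c → 2n- (suc p) (2 ℕ.+ c) ≡ 2n- p c
2n-[2+c]-shift p c =
  trans (2n-c≡2*n-c (suc p) (2 ℕ.+ c)) (trans (shift (+ p) (+ c)) (sym (2n-c≡2*n-c p c)))
  where
  shift : ∀ x y → + 2 * (+ 1 + x) - (+ 2 + y) ≡ + 2 * x - y
  shift = solve-∀

denominator-shift : ∀ t p → denominator (suc t) (suc p) ≡ 2n- (suc p) 1 * denominator t p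
denominator-shift zero    p =
  trans (cong (+ 2 * 2n- (suc p) 1 *_) (2n-[2+c]-shift p 1)) (swap (2n- (suc p) 1) (2n- p 1))
  where
  swap : ∀ a b → + 2 * a * b ≡ a * (+ 2 * b)
  swap = solve-∀
denominator-shift (suc t) p =
  trans (cong₂ _*_ (denominator-shift t p) (2n-[2+c]-shift p (odd (suc t))))
        (*-assoc (2n- (suc p) 1) (denominator t p) (2n- p (odd (suc t))))

-- A record rather than a function type, so that N can be read off a ClosedForm type by unification.
record ClosedForm (t : ℕ) (N : ℤ → ℤ) : Set where
  field closed : ∀ n → denominator t n * B (odd t) n ≡ cbin n * N (+ n)
open ClosedForm

closedForm-step : ∀ {t N N′} → ClosedForm t N →
  (∀ x → let n = + 1 + x in N′ n ≡ n * n * ((+ 2 * n - + odd (suc t)) * N n - (+ 2 * n - + 1) * N x)) →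
  ClosedForm (suc t) N′
-- At x = -1 the recurrence gives N′ 0 ≡ 0.
closedForm-step {t} {N′ = N′} _ recurrence .closed zero =
  trans (*-zeroʳ (denominator (suc t) 0)) (sym (trans (*-identityˡ (N′ (+ 0))) (recurrence -[1+ 0 ])))
closedForm-step {t} {N} {N′} IH recurrence .closed (suc p) = begin
  D * f * B (2 ℕ.+ m) n
    ≡⟨ cong (D * f *_) (B-recurrence m p) ⟩
  D * f * (nn * B m n - c * E * B m p)
    ≡⟨ expand D f nn (B m n) c E (B m p) ⟩
  nn * f * (D * B m n) - c * E * (D * f * B m p)
    ≡⟨ cong₂ (λ a b → nn * f * a - c * E * b) (closed IH n) previous-term ⟩
  nn * f * (Cn * N (+ n)) - c * E * (E * (Cp * N (+ p)))
    ≡⟨ regroup nn f Cn (N (+ n)) c E Cp (N (+ p)) ⟩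
  nn * f * (Cn * N (+ n)) - E * N (+ p) * (c * E * Cp)
    ≡⟨ cong (λ a → nn * f * (Cn * N (+ n)) - E * N (+ p) * a) (cbin-descent p) ⟩
  nn * f * (Cn * N (+ n)) - E * N (+ p) * (nn * Cn)
    ≡⟨ collect nn f Cn (N (+ n)) E (N (+ p)) ⟩
  Cn * (nn * (f * N (+ n) - E * N (+ p)))
    ≡⟨ cong₂ (λ a b → Cn * (nn * (a * N (+ n) - b * N (+ p))))
             (2n-c≡2*n-c n (odd (suc t))) (2n-c≡2*n-c n 1) ⟩
  Cn * (nn * ((+ 2 * + n - + odd (suc t)) * N (+ n) - (+ 2 * + n - + 1) * N (+ p)))
    ≡⟨ cong (Cn *_) (recurrence (+ p)) ⟨
  Cn * N′ (+ n) ∎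
  where
  n = suc p
  m = odd t
  nn = + n * + n
  c = + (2 ℕ.* n)
  D = denominator t n
  f = 2n- n (odd (suc t))
  E = 2n- n 1
  Cn = cbin n
  Cp = cbin p
  previous-term : D * f * B m p ≡ E * (Cp * N (+ p))
  previous-term = trans (cong (_* B m p) (denominator-shift t p))
                        (trans (*-assoc E (denominator t p) (B m p)) (cong (E *_) (closed IH p)))
  expand : ∀ D f nn Bn c E Bp →
    D * f * (nn * Bn - c * E * Bp) ≡ nn * f * (D * Bn) - c * E * (D * f * Bp)
  expand = solve-∀
  regroup : ∀ nn f Cn Nn c E Cp Np →
    nn * f * (Cn * Nn) - c * E * (E * (Cp * Np)) ≡ nn * f * (Cn * Nn) - E * Np * (c * E * Cp)
  regroup = solve-∀
  collect : ∀ nn f Cn Nn E Np →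
    nn * f * (Cn * Nn) - E * Np * (nn * Cn) ≡ Cn * (nn * (f * Nn - E * Np))
  collect = solve-∀

corollary9 : (n : ℕ) → 1 ≤ n →
    ((+ 2 * 2n- n 1) * B 1 n ≡ cbin n * + n)
    × ((+ 2 * 2n- n 1 * 2n- n 3) * B 3 n ≡ cbin n * (- (+ n * + n)))
    × ((+ 2 * 2n- n 1 * 2n- n 3 * 2n- n 5) * B 5 n
         ≡ cbin n * (+ n * + n * (+ 4 * + n - + 1)))
    × ((+ 2 * 2n- n 1 * 2n- n 3 * 2n- n 5 * 2n- n 7) * B 7 n
         ≡ cbin n * (- (+ n * + n * (+ 34 * + n * + n - + 24 * + n + + 5))))
    × ((+ 2 * 2n- n 1 * 2n- n 3 * 2n- n 5 * 2n- n 7 * 2n- n 9) * B 9 n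
         ≡ cbin n * (+ n * + n * (+ 496 * + n * + n * + n - + 672 * + n * + n + + 344 * + n - + 63)))
corollary9 n _ = closed B₁ n , closed B₃ n , closed B₅ n , closed B₇ n , closed B₉ n
  where
  B₁ : ClosedForm 0 (λ x → x)
  B₁ = record { closed = B₁-closed-form }
  B₃ : ClosedForm 1 (λ x → - (x * x))
  B₃ = closedForm-step B₁ solve-∀
  B₅ : ClosedForm 2 (λ x → x * x * (+ 4 * x - + 1))
  B₅ = closedForm-step B₃ solve-∀
  B₇ : ClosedForm 3 (λ x → - (x * x * (+ 34 * x * x - + 24 * x + + 5)))
  B₇ = closedForm-step B₅ solve-∀
  B₉ : ClosedForm 4 (λ x → x * x * (+ 496 * x * x * x - + 672 * x * x + + 344 * x - + 63))
  B₉ = closedForm-step B₇ solve-∀
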